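{- Let $p\in Var$ and $a\in Ag$. Then (1) $\not\vdash_{\mathsf S}I_ap\to B_ap$; (2) $\not\vdash_{\mathsf S}I_ap\to K_ap$; (3) $\not\vdash_{\mathsf S}B_ap\to K_ap$.
   Context: Let $Ag$ be a non-empty finite set of agents and $Var$ a countably infinite set of propositional variables. The formulas $\mathrm{Fm}_{\mathsf S}$ are generated by $\varphi::=p\mid\neg\varphi\mid\varphi\land\varphi\mid I_a\varphi\mid K_a\varphi\mid B_a\varphi$ ($p\in Var$, $a\in Ag$), with $\lor,\to$ classical abbreviations. The logic $\mathsf S$ ($\vdash_{\mathsf S}\varphi$ means $\varphi$ is derivable) has as axioms: all classical tautologies; for each $a$ and $\star\in\{K_a,B_a,I_a\}$, $\star(\varphi\to\psi)\to(\star\varphi\to\star\psi)$; $K_a\varphi\to\varphi$; $K_a\varphi\to K_aK_a\varphi$; $B_a\varphi\to\neg B_a\neg\varphi$; $K_a\varphi\to B_a\varphi$; $B_a\varphi\to K_aB_a\varphi$; $I_a\varphi\to\neg I_a\neg\varphi$; $I_a\varphi\to K_aI_a\varphi$; $I_a\varphi\to I_aK_a\varphi$; $I_a\varphi\to I_aI_a\varphi$; rules: modus ponens and necessitation for each $K_a,B_a,I_a$. -}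

module Defs where

open import Data.Nat using (ℕ; suc)
open import Data.Fin using (Fin)
open import Data.Bool using (Bool; true; false; not; _∧_)

module Logic (n : ℕ) where

  Ag : Set
  Ag = Fin (suc n)

  Var : Set
  Var = ℕ

  infixr 6 _∧'_
  infixr 5 _⇒_ _∨'_

  data Fm : Set where
    var  : Var → Fm
    ¬'_  : Fm → Fm
    _∧'_ : Fm → Fm → Fm
    I K B : Ag → Fm → Fm

  _∨'_ : Fm → Fm → Fm
  φ ∨' ψ = ¬' (¬' φ ∧' ¬' ψ)

  _⇒_ : Fm → Fm → Fm
  φ ⇒ ψ = ¬' (φ ∧' ¬' ψ)

  -- Classical two-valued evaluation, treating modal subformulas as atoms,
  -- to define "classical tautology" (substitution instances of
  -- propositional tautologies).
  eval : (Var → Bool) → (Ag → Fm → Bool) → (Ag → Fm → Bool) → (Ag → Fm → Bool) → Fm → Bool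
  eval v i k b (var x)  = v x
  eval v i k b (¬' φ)   = not (eval v i k b φ)
  eval v i k b (φ ∧' ψ) = eval v i k b φ ∧ eval v i k b ψ
  eval v i k b (I a φ)  = i a φ
  eval v i k b (K a φ)  = k a φ
  eval v i k b (B a φ)  = b a φ

  Tautology : Fm → Set
  Tautology φ = ∀ v i k b → eval v i k b φ ≡ true
    where open import Relation.Binary.PropositionalEquality using (_≡_)

  data ⊢_ : Fm → Set where
    taut  : ∀ {φ} → Tautology φ → ⊢ φ
    K-I   : ∀ a φ ψ → ⊢ (I a (φ ⇒ ψ) ⇒ (I a φ ⇒ I a ψ))
    K-K   : ∀ a φ ψ → ⊢ (K a (φ ⇒ ψ) ⇒ (K a φ ⇒ K a ψ))
    K-B   : ∀ a φ ψ → ⊢ (B a (φ ⇒ ψ) ⇒ (B a φ ⇒ B a ψ))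
    T-K   : ∀ a φ → ⊢ (K a φ ⇒ φ)
    4-K   : ∀ a φ → ⊢ (K a φ ⇒ K a (K a φ))
    D-B   : ∀ a φ → ⊢ (B a φ ⇒ ¬' B a (¬' φ))
    KB    : ∀ a φ → ⊢ (K a φ ⇒ B a φ)
    BKB   : ∀ a φ → ⊢ (B a φ ⇒ K a (B a φ))
    D-I   : ∀ a φ → ⊢ (I a φ ⇒ ¬' I a (¬' φ))
    IKI   : ∀ a φ → ⊢ (I a φ ⇒ K a (I a φ))
    IIK   : ∀ a φ → ⊢ (I a φ ⇒ I a (K a φ))
    III   : ∀ a φ → ⊢ (I a φ ⇒ I a (I a φ))
    mp    : ∀ {φ ψ} → ⊢ (φ ⇒ ψ) → ⊢ φ → ⊢ ψ
    nec-I : ∀ a {φ} → ⊢ φ → ⊢ I a φ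
    nec-K : ∀ a {φ} → ⊢ φ → ⊢ K a φ
    nec-B : ∀ a {φ} → ⊢ φ → ⊢ B a φ

-- A Kripke model with accessibility relations Rᴵ, Rᴷ, Rᴮ per agent validates S as
-- soon as its frame satisfies the correspondents of the axioms: Rᴷ is a preorder,
-- Rᴮ and Rᴵ are serial, Rᴵ is transitive, Rᴮ ⊆ Rᴷ, and Rᴷ⨾Rᴮ ⊆ Rᴮ, Rᴷ⨾Rᴵ ⊆ Rᴵ,
-- Rᴵ⨾Rᴷ ⊆ Rᴵ. Two-world models, with p true exactly at world 0, then refute the
-- implications at world 1: if Rᴷ = Rᴮ is the identity and Rᴵ points every world
-- to world 0, then Iₐp holds there but neither Bₐp nor Kₐp does; if Rᴵ and Rᴷ are
-- universal and Rᴮ points to world 0, then Bₐp holds there but Kₐp does not.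
{-# OPTIONS --safe #-}
module Submission where

open import Defs
open import Data.Bool using (Bool; true; false; not; _∧_; T)
open import Data.Bool.Properties using (T-≡)
open import Data.Fin using (Fin; zero; suc)
open import Data.Fin.Properties using (all?; _≟_)
open import Data.Nat using (ℕ; suc)
open import Data.Product using (_×_; _,_; ∃)
open import Data.Unit using (⊤; tt)
open import Function using (_∘_)
open import Function.Bundles using (Equivalence)
open import Level using (0ℓ)
open import Relation.Binary.Core using (Rel) renaming (_⇒_ to _⊆_)
open import Relation.Binary.Definitions using (Decidable; Reflexive; Transitive; Trans)
open import Relation.Binary.PropositionalEquality using (_≡_; refl; cong; cong₂; trans; subst)
open import Relation.Nullary using (¬_; yes)
open import Relation.Nullary.Decidable using (isYes; _→-dec_; T?; toWitness; fromWitness)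

module Semantics (n : ℕ) where
  open Logic n

  □ : ∀ {m} {R : Rel (Fin m) 0ℓ} → Decidable R → (Fin m → Bool) → Fin m → Bool
  □ R? f w = isYes (all? (λ v → R? w v →-dec T? (f v)))

  □-intro : ∀ {m} {R : Rel (Fin m) 0ℓ} (R? : Decidable R) {f w} →
            (∀ {v} → R w v → T (f v)) → T (□ R? f w)
  □-intro R? h = fromWitness (λ v → h)

  □-elim : ∀ {m} {R : Rel (Fin m) 0ℓ} (R? : Decidable R) {f w v} →
           T (□ R? f w) → R w v → T (f v)
  □-elim R? h = toWitness h _

  record Model (m : ℕ) : Set₁ where
    field
      Rᴵ Rᴷ Rᴮ : Ag → Rel (Fin m) 0ℓ
      Rᴵ? : ∀ a → Decidable (Rᴵ a)
      Rᴷ? : ∀ a → Decidable (Rᴷ a)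
      Rᴮ? : ∀ a → Decidable (Rᴮ a)
      V : Var → Fin m → Bool

    sat : Fin m → Fm → Bool
    sat w (var x)  = V x w
    sat w (¬' φ)   = not (sat w φ)
    sat w (φ ∧' ψ) = sat w φ ∧ sat w ψ
    sat w (I a φ)  = □ (Rᴵ? a) (λ v → sat v φ) w
    sat w (K a φ)  = □ (Rᴷ? a) (λ v → sat v φ) w
    sat w (B a φ)  = □ (Rᴮ? a) (λ v → sat v φ) w

    infix 4 _⊨_
    _⊨_ : Fin m → Fm → Set
    w ⊨ φ = T (sat w φ)

    sat-eval : ∀ w φ → sat w φ ≡ eval (λ x → V x w) (λ a ψ → sat w (I a ψ))
                                      (λ a ψ → sat w (K a ψ)) (λ a ψ → sat w (B a ψ)) φ
    sat-eval w (var x)  = refl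
    sat-eval w (¬' φ)   = cong not (sat-eval w φ)
    sat-eval w (φ ∧' ψ) = cong₂ _∧_ (sat-eval w φ) (sat-eval w ψ)
    sat-eval w (I a φ)  = refl
    sat-eval w (K a φ)  = refl
    sat-eval w (B a φ)  = refl

    ⊨-tautology : ∀ φ → Tautology φ → ∀ w → w ⊨ φ
    ⊨-tautology φ t w = Equivalence.from T-≡ (trans (sat-eval w φ) (t _ _ _ _))

    ⊨¬-intro : ∀ {w} φ → ¬ (w ⊨ φ) → w ⊨ ¬' φ
    ⊨¬-intro {w} φ h with sat w φ
    ... | true  = h _
    ... | false = _

    ⊨¬-elim : ∀ {w} φ → w ⊨ ¬' φ → ¬ (w ⊨ φ)
    ⊨¬-elim {w} φ h with sat w φ
    ... | false = λ ()

    ⊨⇒-intro : ∀ {w} φ ψ → (w ⊨ φ → w ⊨ ψ) → w ⊨ φ ⇒ ψ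
    ⊨⇒-intro {w} φ ψ h with sat w φ | sat w ψ
    ... | true  | true  = _
    ... | true  | false = h _
    ... | false | _     = _

    ⊨⇒-elim : ∀ {w} φ ψ → w ⊨ φ ⇒ ψ → w ⊨ φ → w ⊨ ψ
    ⊨⇒-elim {w} φ ψ h with sat w φ | sat w ψ
    ... | true | true = _

  module _ {m} (M : Model m) where
    open Model M
    private
      variable
        R S R⨾S : Rel (Fin m) 0ℓ

    ⟦_⟧ : Fm → Fin m → Bool
    ⟦ φ ⟧ v = sat v φ

    □-distrib-⇒ : (R? : Decidable R) (φ ψ : Fm) →
                  ∀ {w} → T (□ R? ⟦ φ ⇒ ψ ⟧ w) → T (□ R? ⟦ φ ⟧ w) → T (□ R? ⟦ ψ ⟧ w)
    □-distrib-⇒ R? φ ψ h hφ = □-intro R? λ r → ⊨⇒-elim φ ψ (□-elim R? h r) (□-elim R? hφ r)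

    □-reflexive : (R? : Decidable R) → Reflexive R →
                  ∀ φ {w} → T (□ R? ⟦ φ ⟧ w) → T (⟦ φ ⟧ w)
    □-reflexive R? R-refl φ h = □-elim R? h R-refl

    □-serial : (R? : Decidable R) → (∀ w → ∃ (R w)) →
               ∀ φ {w} → T (□ R? ⟦ φ ⟧ w) → ¬ T (□ R? ⟦ ¬' φ ⟧ w)
    □-serial R? serial φ {w} h h¬ with serial w
    ... | v , r = ⊨¬-elim φ (□-elim R? h¬ r) (□-elim R? h r)

    □-antitone : (R? : Decidable R) (S? : Decidable S) → S ⊆ R →
                 ∀ φ {w} → T (□ R? ⟦ φ ⟧ w) → T (□ S? ⟦ φ ⟧ w)
    □-antitone R? S? S⊆R φ h = □-intro S? (□-elim R? h ∘ S⊆R)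

    □-trans : (R? : Decidable R) (S? : Decidable S) (R⨾S? : Decidable R⨾S) → Trans R S R⨾S →
              ∀ φ {w} → T (□ R⨾S? ⟦ φ ⟧ w) → T (□ R? (□ S? ⟦ φ ⟧) w)
    □-trans R? S? R⨾S? compose φ h =
      □-intro R? λ r → □-intro S? λ s → □-elim R⨾S? h (compose r s)

  record IsSModel {m} (M : Model m) : Set where
    open Model M
    field
      Rᴷ-refl     : ∀ a → Reflexive (Rᴷ a)
      Rᴷ-trans    : ∀ a → Transitive (Rᴷ a)
      Rᴮ-serial   : ∀ a w → ∃ (Rᴮ a w)
      Rᴮ⊆Rᴷ       : ∀ a → Rᴮ a ⊆ Rᴷ a
      Rᴷ⨾Rᴮ⊆Rᴮ    : ∀ a → Trans (Rᴷ a) (Rᴮ a) (Rᴮ a)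
      Rᴵ-serial   : ∀ a w → ∃ (Rᴵ a w)
      Rᴷ⨾Rᴵ⊆Rᴵ    : ∀ a → Trans (Rᴷ a) (Rᴵ a) (Rᴵ a)
      Rᴵ⨾Rᴷ⊆Rᴵ    : ∀ a → Trans (Rᴵ a) (Rᴷ a) (Rᴵ a)
      Rᴵ-trans    : ∀ a → Transitive (Rᴵ a)

  soundness : ∀ {m} {M : Model m} → IsSModel M → ∀ {φ} → ⊢ φ → ∀ w → Model._⊨_ M w φ
  soundness {M = M} S = sound
    where
    open Model M
    open IsSModel S

    sound : ∀ {φ} → ⊢ φ → ∀ w → w ⊨ φ
    sound (taut {φ} t) = ⊨-tautology φ t
    sound (K-I a φ ψ) _ = ⊨⇒-intro (I a (φ ⇒ ψ)) (I a φ ⇒ I a ψ) λ h →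
                            ⊨⇒-intro (I a φ) (I a ψ) (□-distrib-⇒ M (Rᴵ? a) φ ψ h)
    sound (K-K a φ ψ) _ = ⊨⇒-intro (K a (φ ⇒ ψ)) (K a φ ⇒ K a ψ) λ h →
                            ⊨⇒-intro (K a φ) (K a ψ) (□-distrib-⇒ M (Rᴷ? a) φ ψ h)
    sound (K-B a φ ψ) _ = ⊨⇒-intro (B a (φ ⇒ ψ)) (B a φ ⇒ B a ψ) λ h →
                            ⊨⇒-intro (B a φ) (B a ψ) (□-distrib-⇒ M (Rᴮ? a) φ ψ h)
    sound (T-K a φ) _ = ⊨⇒-intro (K a φ) φ (□-reflexive M (Rᴷ? a) (Rᴷ-refl a) φ)
    sound (4-K a φ) _ =
      ⊨⇒-intro (K a φ) (K a (K a φ)) (□-trans M (Rᴷ? a) (Rᴷ? a) (Rᴷ? a) (Rᴷ-trans a) φ)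
    sound (D-B a φ) _ = ⊨⇒-intro (B a φ) (¬' B a (¬' φ)) λ h →
                          ⊨¬-intro (B a (¬' φ)) (□-serial M (Rᴮ? a) (Rᴮ-serial a) φ h)
    sound (KB a φ) _ = ⊨⇒-intro (K a φ) (B a φ) (□-antitone M (Rᴷ? a) (Rᴮ? a) (Rᴮ⊆Rᴷ a) φ)
    sound (BKB a φ) _ =
      ⊨⇒-intro (B a φ) (K a (B a φ)) (□-trans M (Rᴷ? a) (Rᴮ? a) (Rᴮ? a) (Rᴷ⨾Rᴮ⊆Rᴮ a) φ)
    sound (D-I a φ) _ = ⊨⇒-intro (I a φ) (¬' I a (¬' φ)) λ h →
                          ⊨¬-intro (I a (¬' φ)) (□-serial M (Rᴵ? a) (Rᴵ-serial a) φ h)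
    sound (IKI a φ) _ =
      ⊨⇒-intro (I a φ) (K a (I a φ)) (□-trans M (Rᴷ? a) (Rᴵ? a) (Rᴵ? a) (Rᴷ⨾Rᴵ⊆Rᴵ a) φ)
    sound (IIK a φ) _ =
      ⊨⇒-intro (I a φ) (I a (K a φ)) (□-trans M (Rᴵ? a) (Rᴷ? a) (Rᴵ? a) (Rᴵ⨾Rᴷ⊆Rᴵ a) φ)
    sound (III a φ) _ =
      ⊨⇒-intro (I a φ) (I a (I a φ)) (□-trans M (Rᴵ? a) (Rᴵ? a) (Rᴵ? a) (Rᴵ-trans a) φ)
    sound (mp {φ} {ψ} d e) w = ⊨⇒-elim φ ψ (sound d w) (sound e w)
    sound (nec-I a d) _ = □-intro (Rᴵ? a) λ {v} _ → sound d v
    sound (nec-K a d) _ = □-intro (Rᴷ? a) λ {v} _ → sound d v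
    sound (nec-B a d) _ = □-intro (Rᴮ? a) λ {v} _ → sound d v

  refuted⇒unprovable : ∀ {m} {M : Model m} → IsSModel M →
                       ∀ {φ} w → Model.sat M w φ ≡ false → ¬ (⊢ φ)
  refuted⇒unprovable S w refuted d = subst T refuted (soundness S d w)

  holds-at-zero : Fin 2 → Bool
  holds-at-zero zero    = true
  holds-at-zero (suc _) = false

  countermodel-I⇒B : Model 2
  countermodel-I⇒B = record
    { Rᴵ = λ _ _ v → v ≡ zero ; Rᴷ = λ _ → _≡_ ; Rᴮ = λ _ → _≡_
    ; Rᴵ? = λ _ _ v → v ≟ zero ; Rᴷ? = λ _ → _≟_ ; Rᴮ? = λ _ → _≟_
    ; V = λ _ → holds-at-zero
    }

  countermodel-I⇒B-isSModel : IsSModel countermodel-I⇒B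
  countermodel-I⇒B-isSModel = record
    { Rᴷ-refl   = λ _ → refl
    ; Rᴷ-trans  = λ _ → trans
    ; Rᴮ-serial = λ _ w → w , refl
    ; Rᴮ⊆Rᴷ     = λ _ r → r
    ; Rᴷ⨾Rᴮ⊆Rᴮ  = λ { _ refl r → r }
    ; Rᴵ-serial = λ _ _ → zero , refl
    ; Rᴷ⨾Rᴵ⊆Rᴵ  = λ { _ refl r → r }
    ; Rᴵ⨾Rᴷ⊆Rᴵ  = λ { _ r refl → r }
    ; Rᴵ-trans  = λ _ _ r → r
    }

  countermodel-B⇒K : Model 2
  countermodel-B⇒K = record
    { Rᴵ = λ _ _ _ → ⊤ ; Rᴷ = λ _ _ _ → ⊤ ; Rᴮ = λ _ _ v → v ≡ zero
    ; Rᴵ? = λ _ _ _ → yes tt ; Rᴷ? = λ _ _ _ → yes tt ; Rᴮ? = λ _ _ v → v ≟ zero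
    ; V = λ _ → holds-at-zero
    }

  countermodel-B⇒K-isSModel : IsSModel countermodel-B⇒K
  countermodel-B⇒K-isSModel = record
    { Rᴷ-refl   = λ _ → tt
    ; Rᴷ-trans  = λ _ _ _ → tt
    ; Rᴮ-serial = λ _ _ → zero , refl
    ; Rᴮ⊆Rᴷ     = λ _ _ → tt
    ; Rᴷ⨾Rᴮ⊆Rᴮ  = λ _ _ r → r
    ; Rᴵ-serial = λ _ _ → zero , tt
    ; Rᴷ⨾Rᴵ⊆Rᴵ  = λ _ _ _ → tt
    ; Rᴵ⨾Rᴷ⊆Rᴵ  = λ _ _ _ → tt
    ; Rᴵ-trans  = λ _ _ _ → tt
    }

proposition1 : (n : ℕ) → let open Logic n in (p : Var) (a : Ag) →
    (¬ (⊢ (I a (var p) ⇒ B a (var p))))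
    × (¬ (⊢ (I a (var p) ⇒ K a (var p))))
    × (¬ (⊢ (B a (var p) ⇒ K a (var p))))
proposition1 n p a =
    refuted⇒unprovable countermodel-I⇒B-isSModel (suc zero) refl
  , refuted⇒unprovable countermodel-I⇒B-isSModel (suc zero) refl
  , refuted⇒unprovable countermodel-B⇒K-isSModel (suc zero) refl
  where open Semantics n
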